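{- Modularity optimization violates Standard Consistency and Refinement Consistency. That is, there exist a network $N=(V,E)$, a modularity-optimal clustering $\Gamma$ of $N$, and a network $N'=(V,E')$ obtained from $N$ by adding edges whose two endpoints lie in a common cluster of $\Gamma$, such that $\Gamma$ is not modularity-optimal for $N'$ and no modularity-optimal clustering of $N'$ has all its clusters contained in clusters of $\Gamma$.
   Context: A network is a finite simple undirected unweighted graph $N=(V,E)$; a clustering is a partition of $V$ into nonempty clusters. For Modularity only clusterings whose clusters each induce a connected subgraph are admissible. The Modularity score of a clustering $\mathcal{C}$ is $\sum_{c\in\mathcal{C}}\left[\frac{e_c}{|E|}-\left(\frac{d_c}{2|E|}\right)^2\right]$, where $e_c$ is the number of edges with both endpoints in $c$ and $d_c$ is the sum of the degrees in $N$ of the vertices in $c$. A modularity-optimal clustering is an admissible clustering of maximum score. Standard Consistency requires that an optimal clustering $\Gamma$ of $N$ remain optimal after deleting edges between different clusters of $\Gamma$ and/or adding edges inside clusters of $\Gamma$; Refinement Consistency requires only that, after such changes, some optimal clustering have every cluster contained in a cluster of $\Gamma$. -}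

module Defs where

open import Data.Bool using (Bool; true; false; _∧_)
open import Data.Nat using (ℕ; zero; suc; _*_; _<_)
open import Data.Fin using (Fin; toℕ)
open import Data.Fin.Properties using (_≟_)
open import Data.List using (List; map; foldr)
open import Data.Nat.ListAction using (sum)
open import Data.List.Base using (allFin)
open import Data.Integer using (+_)
open import Data.Rational using (ℚ; 0ℚ; _/_; _+_; _-_; _≤_)
import Data.Rational as ℚ
open import Data.Product using (∃; _×_)
open import Relation.Nullary using (¬_; does)
open import Relation.Binary.PropositionalEquality using (_≡_)

record Network (n : ℕ) : Set where
  field
    adj    : Fin n → Fin n → Bool
    sym    : ∀ i j → adj i j ≡ adj j i
    irrefl : ∀ i → adj i i ≡ false
open Network public

-- A clustering is given by a labelling of the vertices; the clusters are the
-- nonempty fibres of the labelling (so every partition of V arises this way).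
Clustering : ℕ → Set
Clustering n = Fin n → Fin n

sumFin : ∀ {n} → (Fin n → ℕ) → ℕ
sumFin {n} f = sum (map f (allFin n))

sumℚ : ∀ {n} → (Fin n → ℚ) → ℚ
sumℚ {n} f = foldr _+_ 0ℚ (map f (allFin n))

b2n : Bool → ℕ
b2n true  = 1
b2n false = 0

lt : ∀ {n} → Fin n → Fin n → Bool
lt i j = does (toℕ i Data.Nat.<? toℕ j)

edgeCount : ∀ {n} → Network n → ℕ
edgeCount N = sumFin λ i → sumFin λ j → b2n (lt i j ∧ adj N i j)

degree : ∀ {n} → Network n → Fin n → ℕ
degree N v = sumFin λ j → b2n (adj N v j)

inCluster : ∀ {n} → Clustering n → Fin n → Fin n → Bool
inCluster C k v = does (C v ≟ k)

innerEdges : ∀ {n} → Network n → Clustering n → Fin n → ℕ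
innerEdges N C k = sumFin λ i → sumFin λ j →
  b2n (lt i j ∧ adj N i j ∧ inCluster C k i ∧ inCluster C k j)

clusterDegree : ∀ {n} → Network n → Clustering n → Fin n → ℕ
clusterDegree N C k = sumFin λ v → b2n (inCluster C k v) * degree N v

-- Modularity score (defined to be 0 when |E| = 0, where it is undefined;
-- optimality below requires |E| > 0). Empty labels contribute 0.
modularity : ∀ {n} → Network n → Clustering n → ℚ
modularity {n} N C with edgeCount N
... | zero  = 0ℚ
... | suc m = sumℚ λ k →
  ((+ innerEdges N C k) / suc m) -
  ((+ clusterDegree N C k) / (2 * suc m)) ℚ.* ((+ clusterDegree N C k) / (2 * suc m))

data WalkIn {n} (N : Network n) (P : Fin n → Set) : Fin n → Fin n → Set where
  here : ∀ {u} → P u → WalkIn N P u u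
  step : ∀ {u v w} → P u → adj N u v ≡ true → WalkIn N P v w → WalkIn N P u w

Admissible : ∀ {n} → Network n → Clustering n → Set
Admissible N C = ∀ u v → C u ≡ C v → WalkIn N (λ x → C x ≡ C u) u v

ModOptimal : ∀ {n} → Network n → Clustering n → Set
ModOptimal N Γ = (0 < edgeCount N) × Admissible N Γ ×
  (∀ C → Admissible N C → modularity N C ≤ modularity N Γ)

Refines : ∀ {n} → Clustering n → Clustering n → Set
Refines C Γ = ∀ u v → C u ≡ C v → Γ u ≡ Γ v

AddsIntraEdges : ∀ {n} → Network n → Clustering n → Network n → Set
AddsIntraEdges N Γ N' =
  (∀ i j → adj N i j ≡ true → adj N' i j ≡ true) ×
  (∀ i j → adj N' i j ≡ true → adj N i j ≡ false → Γ i ≡ Γ j)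

{-# OPTIONS --safe #-}
module Submission where

-- Take a hub 0 joined to 1, …, 5, together with the edges 12 and 13. The clustering
-- Γ = {0,4,5} {1,2,3} is modularity-optimal; adding the edge 45 inside {0,4,5} makes
-- Δ = {0,1,2,3} {4,5} strictly better than every clustering refining Γ, Γ included.
-- With e edges, the modularity of C is (4e·E_C − D_C) / 4e², where E_C counts the edges
-- inside clusters and D_C sums d_i d_j over the ordered pairs sharing a cluster; both depend
-- only on the partition. Giving every vertex the index of its least cluster-mate as label
-- represents each partition of six vertices by a labelling whose label at vertex i is at
-- most i, so both claims reduce to comparing integer scores over 720 labellings.

open import Defs
open import Data.Bool using (Bool; true; false; _∧_; _∨_)
import Data.Bool as Bool
open import Data.Bool.Properties using (∨-comm)
open import Data.Fin using (Fin; Fin′; zero; suc; toℕ; fromℕ<; inject; _↑ˡ_)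
open import Data.Fin.Patterns using (0F; 1F; 2F; 3F; 4F; 5F)
open import Data.Fin.Properties using (_≟_; all?; toℕ-injective; toℕ-inject; toℕ-↑ˡ; toℕ-fromℕ<; ¬∀⟶∃¬-smallest)
open import Data.Integer as ℤ using (ℤ; +_)
import Data.Integer.Properties as ℤ
open import Data.Integer.Tactic.RingSolver using (solve-∀)
import Data.List as List
open import Data.Nat as ℕ using (ℕ; zero; suc; _+_; _*_; _≤_; s≤s; z≤n)
import Data.Nat.Properties as ℕ
open import Algebra.Properties.Semiring.Sum ℕ.+-*-semiring
  using (sum; sum-cong-≗; sum-replicate-zero; ∑-comm; *-distribˡ-sum; *-distribʳ-sum)
open import Data.Nat.Solver using (module +-*-Solver)
open import Data.Product using (Σ; ∃; _×_; _,_; proj₁; proj₂)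
open import Data.Rational as ℚ using (ℚ; 0ℚ; _/_; toℚᵘ)
import Data.Rational.Properties as ℚ
open import Data.Rational.Unnormalised as ℚᵘ using (mkℚᵘ; *≡*; *≤*; *<*)
import Data.Rational.Unnormalised.Properties as ℚᵘ
open import Data.Sum using (_⊎_; inj₁; inj₂)
open import Data.Unit using (tt)
open import Data.Vec using (_∷_; []; lookup)
import Data.Vec.Functional as Vector
open import Function using (_∘_; id; mk⇔)
open import Relation.Binary.PropositionalEquality as ≡ using (_≡_; _≢_; _≗_; refl; cong; cong₂; trans; subst)
open import Relation.Nullary using (¬_; Dec; does; ¬?)
open import Relation.Nullary.Decidable using (toWitness; does-⇔; decidable-stable; _×-dec_; _⊎-dec_; _→-dec_)

foldr-map-tabulate : ∀ {A B : Set} (_∙_ : A → A → A) (ε : A) (f : B → A) {n} (g : Fin n → B) →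
                     List.foldr _∙_ ε (List.map f (List.tabulate g)) ≡ Vector.foldr _∙_ ε (f ∘ g)
foldr-map-tabulate _∙_ ε f {zero}  g = refl
foldr-map-tabulate _∙_ ε f {suc n} g = cong (f (g zero) ∙_) (foldr-map-tabulate _∙_ ε f (g ∘ suc))

sumFin≡sum : ∀ {n} (f : Fin n → ℕ) → sumFin f ≡ sum f
sumFin≡sum f = foldr-map-tabulate _+_ 0 f id

sumℚ≡foldr : ∀ {n} (f : Fin n → ℚ) → sumℚ f ≡ Vector.foldr ℚ._+_ 0ℚ f
sumℚ≡foldr f = foldr-map-tabulate ℚ._+_ 0ℚ f id

∑-sift : ∀ {n} (x : Fin n) (f : Fin n → ℕ) → sum (λ k → b2n (does (x ≟ k)) * f k) ≡ f x
∑-sift {suc n} zero    f = trans (cong₂ _+_ (ℕ.*-identityˡ (f zero)) (sum-replicate-zero n)) (ℕ.+-identityʳ (f zero))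
∑-sift {suc n} (suc x) f = ∑-sift x (f ∘ suc)

b2n-∧⁴ : ∀ a b c d → b2n (a ∧ b ∧ c ∧ d) ≡ b2n (a ∧ b) * (b2n c * b2n d)
b2n-∧⁴ false b     c     d     = refl
b2n-∧⁴ true  false c     d     = refl
b2n-∧⁴ true  true  false d     = refl
b2n-∧⁴ true  true  true  false = refl
b2n-∧⁴ true  true  true  true  = refl

coclustered : ∀ {n} → Clustering n → Fin n → Fin n → ℕ
coclustered C i = b2n ∘ inCluster C (C i)

pairSum : ∀ {n} → (Fin n → Fin n → ℕ) → Clustering n → ℕ
pairSum w C = sum λ i → sum λ j → w i j * coclustered C i j

∑-labels≡pairSum : ∀ {n} (C : Clustering n) (w : Fin n → Fin n → ℕ) →
                   sum (λ k → sum λ i → sum λ j → w i j * (b2n (inCluster C k i) * b2n (inCluster C k j)))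
                   ≡ pairSum w C
∑-labels≡pairSum C w = begin
  sum (λ k → sum λ i → sum λ j → F k i j)   ≡⟨ ∑-comm (λ k i → sum λ j → F k i j) ⟩
  sum (λ i → sum λ k → sum λ j → F k i j)   ≡⟨ sum-cong-≗ (λ i → ∑-comm λ k j → F k i j) ⟩
  sum (λ i → sum λ j → sum λ k → F k i j)
    ≡⟨ sum-cong-≗ (λ i → sum-cong-≗ λ j → ≡.sym (*-distribˡ-sum (w i j) λ k → I k i * I k j)) ⟩
  sum (λ i → sum λ j → w i j * sum λ k → I k i * I k j)
    ≡⟨ sum-cong-≗ (λ i → sum-cong-≗ λ j → cong (w i j *_) (∑-sift (C i) λ k → I k j)) ⟩
  pairSum w C                               ∎
  where
  open ≡.≡-Reasoning
  I = λ k v → b2n (inCluster C k v)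
  F = λ k i j → w i j * (I k i * I k j)

edgeWeight : ∀ {n} → Network n → Fin n → Fin n → ℕ
edgeWeight N i j = b2n (lt i j ∧ adj N i j)

degreeWeight : ∀ {n} → (Fin n → ℕ) → Fin n → Fin n → ℕ
degreeWeight d i j = d i * d j

∑-innerEdges : ∀ {n} (N : Network n) (C : Clustering n) → sum (innerEdges N C) ≡ pairSum (edgeWeight N) C
∑-innerEdges {n} N C = trans (sum-cong-≗ pointwise) (∑-labels≡pairSum C (edgeWeight N))
  where
  I = λ k v → b2n (inCluster C k v)
  pointwise : ∀ k → innerEdges N C k ≡ sum λ i → sum λ j → edgeWeight N i j * (I k i * I k j)
  pointwise k = trans (sumFin≡sum {n} _) (sum-cong-≗ λ i → trans (sumFin≡sum {n} _) (sum-cong-≗ λ j →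
    b2n-∧⁴ (lt i j) (adj N i j) (inCluster C k i) (inCluster C k j)))

∑-clusterDegree² : ∀ {n} (N : Network n) (C : Clustering n) →
                   sum (λ k → clusterDegree N C k * clusterDegree N C k) ≡ pairSum (degreeWeight (degree N)) C
∑-clusterDegree² N C = trans (sum-cong-≗ square) (∑-labels≡pairSum C (degreeWeight (degree N)))
  where
  open +-*-Solver
  I = λ k v → b2n (inCluster C k v)
  d = degree N
  square : ∀ k → clusterDegree N C k * clusterDegree N C k ≡ sum λ i → sum λ j → d i * d j * (I k i * I k j)
  square k rewrite sumFin≡sum (λ v → I k v * d v) =
    trans (*-distribʳ-sum (sum λ j → I k j * d j) (λ i → I k i * d i)) (sum-cong-≗ λ i →
      trans (*-distribˡ-sum (I k i * d i) (λ j → I k j * d j)) (sum-cong-≗ λ j →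
        solve 4 (λ a x b y → (a :* x) :* (b :* y) := (x :* y) :* (a :* b)) refl (I k i) (d i) (I k j) (d j)))

modularityTerm : ℕ → ℕ → ℕ → ℚ
modularityTerm m a d = ((+ a) / suc m) ℚ.- ((+ d) / (2 * suc m)) ℚ.* ((+ d) / (2 * suc m))

-- modularity N C unfolds to modularity′ m N C as soon as edgeCount N evaluates to suc m.
modularity′ : ∀ {n} → ℕ → Network n → Clustering n → ℚ
modularity′ m N C = sumℚ λ k → modularityTerm m (innerEdges N C k) (clusterDegree N C k)

modularityNumerator : ℕ → ℕ → ℕ → ℤ
modularityNumerator e a b = + (4 * e * a) ℤ.- + b

modularityNumerator-+ : ∀ e a b a′ b′ → modularityNumerator e a b ℤ.+ modularityNumerator e a′ b′
                                        ≡ modularityNumerator e (a + a′) (b + b′)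
modularityNumerator-+ e a b a′ b′
  rewrite ℕ.*-distribˡ-+ (4 * e) a a′ | ℤ.pos-+ (4 * e * a) (4 * e * a′) | ℤ.pos-+ b b′
  = regroup (+ (4 * e * a)) (+ b) (+ (4 * e * a′)) (+ b′)
  where
  regroup : ∀ x y x′ y′ → (x ℤ.- y) ℤ.+ (x′ ℤ.- y′) ≡ (x ℤ.+ x′) ℤ.- (y ℤ.+ y′)
  regroup = solve-∀

toℚᵘ-/ : ∀ x d → toℚᵘ (x / suc d) ℚᵘ.≃ mkℚᵘ x d
toℚᵘ-/ x d = ℚ.toℚᵘ-fromℚᵘ (mkℚᵘ x d)

/-homo-+ : ∀ x y d → (x ℤ.+ y) / suc d ≡ x / suc d ℚ.+ y / suc d
/-homo-+ x y d = ℚ.toℚᵘ-injective (begin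
  toℚᵘ ((x ℤ.+ y) / suc d)                ≈⟨ toℚᵘ-/ (x ℤ.+ y) d ⟩
  mkℚᵘ (x ℤ.+ y) d
    ≈⟨ *≡* (trans (cong ((x ℤ.+ y) ℤ.*_) (ℤ.pos-* (suc d) (suc d))) (identity x y (+ suc d))) ⟩
  mkℚᵘ x d ℚᵘ.+ mkℚᵘ y d                  ≈⟨ ℚᵘ.+-cong (toℚᵘ-/ x d) (toℚᵘ-/ y d) ⟨
  toℚᵘ (x / suc d) ℚᵘ.+ toℚᵘ (y / suc d)  ≈⟨ ℚ.toℚᵘ-homo-+ (x / suc d) (y / suc d) ⟨
  toℚᵘ (x / suc d ℚ.+ y / suc d)          ∎)
  where
  open import Relation.Binary.Reasoning.Setoid ℚᵘ.≃-setoid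
  identity : ∀ x y s → (x ℤ.+ y) ℤ.* (s ℤ.* s) ≡ (x ℤ.* s ℤ.+ y ℤ.* s) ℤ.* s
  identity = solve-∀

/-mono-≤ : ∀ {x y} d → x ℤ.≤ y → x / suc d ℚ.≤ y / suc d
/-mono-≤ {x} {y} d x≤y = ℚ.toℚᵘ-cancel-≤
  (ℚᵘ.≤-respˡ-≃ (ℚᵘ.≃-sym (toℚᵘ-/ x d)) (ℚᵘ.≤-respʳ-≃ (ℚᵘ.≃-sym (toℚᵘ-/ y d))
    (*≤* (ℤ.*-monoʳ-≤-nonNeg (+ suc d) x≤y))))

/-mono-< : ∀ {x y} d → x ℤ.< y → x / suc d ℚ.< y / suc d
/-mono-< {x} {y} d x<y = ℚ.toℚᵘ-cancel-<
  (ℚᵘ.<-respˡ-≃ (ℚᵘ.≃-sym (toℚᵘ-/ x d)) (ℚᵘ.<-respʳ-≃ (ℚᵘ.≃-sym (toℚᵘ-/ y d))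
    (*<* (ℤ.*-monoʳ-<-pos (+ suc d) x<y))))

modularityTerm-≡ : ∀ m a d → modularityTerm m a d ≡ modularityNumerator (suc m) a (d * d) / (4 * suc m * suc m)
modularityTerm-≡ m a d = ℚ.toℚᵘ-injective (begin
  toℚᵘ (x ℚ.- y ℚ.* y)                 ≈⟨ ℚ.toℚᵘ-homo-+ x (ℚ.- (y ℚ.* y)) ⟩
  toℚᵘ x ℚᵘ.+ toℚᵘ (ℚ.- (y ℚ.* y))     ≈⟨ ℚᵘ.+-congʳ (toℚᵘ x) (ℚ.toℚᵘ-homo‿- (y ℚ.* y)) ⟩
  toℚᵘ x ℚᵘ.- toℚᵘ (y ℚ.* y)           ≈⟨ ℚᵘ.+-congʳ (toℚᵘ x) (ℚᵘ.-‿cong (ℚ.toℚᵘ-homo-* y y)) ⟩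
  toℚᵘ x ℚᵘ.- toℚᵘ y ℚᵘ.* toℚᵘ y
    ≈⟨ ℚᵘ.+-cong (toℚᵘ-/ (+ a) m) (ℚᵘ.-‿cong (ℚᵘ.*-cong (toℚᵘ-/ (+ d) _) (toℚᵘ-/ (+ d) _))) ⟩
  mkℚᵘ (+ a) m ℚᵘ.- Y ℚᵘ.* Y           ≈⟨ *≡* numerators ⟩
  mkℚᵘ (modularityNumerator e a (d * d)) _          ≈⟨ toℚᵘ-/ _ _ ⟨
  toℚᵘ (modularityNumerator e a (d * d) / (4 * e * e)) ∎)
  where
  open import Relation.Binary.Reasoning.Setoid ℚᵘ.≃-setoid
  e = suc m
  x = (+ a) / e
  y = (+ d) / (2 * e)
  Y = mkℚᵘ (+ d) (ℕ.pred (2 * e))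
  identity : ∀ A D E → (A ℤ.* ((+ 2 ℤ.* E) ℤ.* (+ 2 ℤ.* E)) ℤ.+ ℤ.- (D ℤ.* D) ℤ.* E) ℤ.* (+ 4 ℤ.* E ℤ.* E)
                     ≡ (+ 4 ℤ.* E ℤ.* A ℤ.- D ℤ.* D) ℤ.* (E ℤ.* ((+ 2 ℤ.* E) ℤ.* (+ 2 ℤ.* E)))
  identity = solve-∀
  numerators : (+ a ℤ.* + (2 * e * (2 * e)) ℤ.+ ℤ.- (+ d ℤ.* + d) ℤ.* + e) ℤ.* + (4 * e * e)
             ≡ (+ (4 * e * a) ℤ.- + (d * d)) ℤ.* + (e * (2 * e * (2 * e)))
  numerators
    rewrite ℤ.pos-* e (2 * e * (2 * e)) | ℤ.pos-* (2 * e) (2 * e) | ℤ.pos-* 2 e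
          | ℤ.pos-* (4 * e) e | ℤ.pos-* (4 * e) a | ℤ.pos-* 4 e | ℤ.pos-* d d
    = identity (+ a) (+ d) (+ e)

∑-modularityTerm : ∀ {n} m (a d : Fin n → ℕ) →
                   Vector.foldr ℚ._+_ 0ℚ (λ k → modularityTerm m (a k) (d k))
                   ≡ modularityNumerator (suc m) (sum a) (sum λ k → d k * d k) / (4 * suc m * suc m)
∑-modularityTerm {zero} m a d =
  ≡.sym (trans (cong (λ z → (+ z ℤ.- + 0) / (4 * suc m * suc m)) (ℕ.*-zeroʳ (4 * suc m)))
               (ℚ.0/n≡0 (4 * suc m * suc m)))
∑-modularityTerm {suc n} m a d = begin
  modularityTerm m (a zero) (d zero) ℚ.+ Vector.foldr ℚ._+_ 0ℚ (λ k → modularityTerm m (a (suc k)) (d (suc k)))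
    ≡⟨ cong₂ ℚ._+_ (modularityTerm-≡ m (a zero) (d zero)) (∑-modularityTerm m (a ∘ suc) (d ∘ suc)) ⟩
  head / D ℚ.+ tail / D       ≡⟨ /-homo-+ head tail (ℕ.pred D) ⟨
  (head ℤ.+ tail) / D
    ≡⟨ cong (_/ D) (modularityNumerator-+ e (a zero) (d zero * d zero) (sum (a ∘ suc)) (sum λ k → d (suc k) * d (suc k))) ⟩
  modularityNumerator e (sum a) (sum λ k → d k * d k) / D ∎
  where
  open ≡.≡-Reasoning
  e = suc m
  D = 4 * e * e
  head = modularityNumerator e (a zero) (d zero * d zero)
  tail = modularityNumerator e (sum (a ∘ suc)) (sum λ k → d (suc k) * d (suc k))

score : ∀ {n} → ℕ → (Fin n → Fin n → ℕ) → (Fin n → ℕ) → Clustering n → ℤ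
score e w d C = modularityNumerator e (pairSum w C) (pairSum (degreeWeight d) C)

modularity′≡score : ∀ {n} m (N : Network n) C →
                    modularity′ m N C ≡ score (suc m) (edgeWeight N) (degree N) C / (4 * suc m * suc m)
modularity′≡score m N C = begin
  modularity′ m N C
    ≡⟨ sumℚ≡foldr (λ k → modularityTerm m (innerEdges N C k) (clusterDegree N C k)) ⟩
  Vector.foldr ℚ._+_ 0ℚ (λ k → modularityTerm m (innerEdges N C k) (clusterDegree N C k))
    ≡⟨ ∑-modularityTerm m (innerEdges N C) (clusterDegree N C) ⟩
  modularityNumerator (suc m) (sum (innerEdges N C)) (sum λ k → clusterDegree N C k * clusterDegree N C k) / (4 * suc m * suc m)
    ≡⟨ cong₂ (λ a b → modularityNumerator (suc m) a b / (4 * suc m * suc m)) (∑-innerEdges N C) (∑-clusterDegree² N C) ⟩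
  score (suc m) (edgeWeight N) (degree N) C / (4 * suc m * suc m) ∎
  where open ≡.≡-Reasoning

SamePartition : ∀ {n} → Clustering n → Clustering n → Set
SamePartition C C′ = Refines C C′ × Refines C′ C

Refines-trans : ∀ {n} {C C′ C″ : Clustering n} → Refines C C′ → Refines C′ C″ → Refines C C″
Refines-trans C⊑C′ C′⊑C″ u v = C′⊑C″ u v ∘ C⊑C′ u v

SamePartition-trans : ∀ {n} {C C′ C″ : Clustering n} → SamePartition C C′ → SamePartition C′ C″ → SamePartition C C″
SamePartition-trans (C⊑C′ , C′⊑C) (C′⊑C″ , C″⊑C′) = Refines-trans C⊑C′ C′⊑C″ , Refines-trans C″⊑C′ C′⊑C

≗⇒SamePartition : ∀ {n} {C C′ : Clustering n} → C ≗ C′ → SamePartition C C′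
≗⇒SamePartition C≗C′ = (λ u v e → trans (≡.sym (C≗C′ u)) (trans e (C≗C′ v)))
                     , (λ u v e → trans (C≗C′ u) (trans e (≡.sym (C≗C′ v))))

refines? : ∀ {n} (C C′ : Clustering n) → Dec (Refines C C′)
refines? C C′ = all? λ u → all? λ v → (C u ≟ C v) →-dec (C′ u ≟ C′ v)

coclustered-cong : ∀ {n} {C C′ : Clustering n} → SamePartition C C′ → ∀ i j → coclustered C i j ≡ coclustered C′ i j
coclustered-cong {C = C} {C′} (C⊑C′ , C′⊑C) i j =
  cong b2n (does-⇔ (mk⇔ (C⊑C′ j i) (C′⊑C j i)) (C j ≟ C i) (C′ j ≟ C′ i))

pairSum-cong : ∀ {n} (w : Fin n → Fin n → ℕ) {C C′ : Clustering n} → SamePartition C C′ → pairSum w C ≡ pairSum w C′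
pairSum-cong w same = sum-cong-≗ λ i → sum-cong-≗ λ j → cong (w i j *_) (coclustered-cong same i j)

score-cong : ∀ {n} e w d {C C′ : Clustering n} → SamePartition C C′ → score e w d C ≡ score e w d C′
score-cong e w d same = cong₂ (modularityNumerator e) (pairSum-cong w same) (pairSum-cong (degreeWeight d) same)

score-cong-degrees : ∀ {n} e w {d d′ : Fin n → ℕ} → d ≗ d′ → ∀ C → score e w d C ≡ score e w d′ C
score-cong-degrees e w d≗d′ C = cong (modularityNumerator e (pairSum w C))
  (sum-cong-≗ λ i → sum-cong-≗ λ j → cong₂ (λ x y → x * y * coclustered C i j) (d≗d′ i) (d≗d′ j))

firstMember : ∀ {n} (C : Clustering n) i → ∃ λ r → ¬ C r ≢ C i × ((j : Fin′ r) → C (inject j) ≢ C i)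
firstMember {n} C i = ¬∀⟶∃¬-smallest n (λ j → C j ≢ C i) (λ j → ¬? (C j ≟ C i)) (λ notMember → notMember i refl)

canonical : ∀ {n} → Clustering n → Clustering n
canonical C i = proj₁ (firstMember C i)

canonical-member : ∀ {n} (C : Clustering n) i → C (canonical C i) ≡ C i
canonical-member C i = decidable-stable (C (canonical C i) ≟ C i) (proj₁ (proj₂ (firstMember C i)))

canonical-least : ∀ {n} (C : Clustering n) {i j} → C j ≡ C i → toℕ (canonical C i) ≤ toℕ j
canonical-least C {i} {j} Cj≡Ci = ℕ.≮⇒≥ λ j<r →
  proj₂ (proj₂ (firstMember C i)) (fromℕ< j<r) (subst (λ v → C v ≡ C i) (≡.sym (inject-fromℕ< j<r)) Cj≡Ci)
  where
  inject-fromℕ< : ∀ {r} (j<r : toℕ j ℕ.< toℕ r) → inject (fromℕ< j<r) ≡ j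
  inject-fromℕ< j<r = toℕ-injective (trans (toℕ-inject (fromℕ< j<r)) (toℕ-fromℕ< j<r))

canonical-samePartition : ∀ {n} (C : Clustering n) → SamePartition (canonical C) C
canonical-samePartition C =
    (λ u v e → trans (≡.sym (canonical-member C u)) (trans (cong C e) (canonical-member C v)))
  , (λ u v e → toℕ-injective (ℕ.≤-antisym
      (canonical-least C (trans (canonical-member C v) (≡.sym e)))
      (canonical-least C (trans (canonical-member C u) e))))

labelling : Fin 1 → Fin 2 → Fin 3 → Fin 4 → Fin 5 → Fin 6 → Clustering 6
labelling a b c d e f = lookup ((a ↑ˡ 5) ∷ (b ↑ˡ 4) ∷ (c ↑ˡ 3) ∷ (d ↑ˡ 2) ∷ (e ↑ˡ 1) ∷ f ∷ [])

∀-labelling? : {P : Clustering 6 → Set} → (∀ C → Dec (P C)) → Dec (∀ a b c d e f → P (labelling a b c d e f))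
∀-labelling? P? = all? λ a → all? λ b → all? λ c → all? λ d → all? λ e → all? λ f → P? (labelling a b c d e f)

boundedCanonical : ∀ {n} (C : Clustering n) i → Fin (suc (toℕ i))
boundedCanonical C i = fromℕ< (s≤s (canonical-least C refl))

toℕ-↑ˡ-boundedCanonical : ∀ {n} (C : Clustering n) i k → toℕ (boundedCanonical C i ↑ˡ k) ≡ toℕ (canonical C i)
toℕ-↑ˡ-boundedCanonical C i k = trans (toℕ-↑ˡ (boundedCanonical C i) k) (toℕ-fromℕ< _)

canonicalLabelling : Clustering 6 → Clustering 6
canonicalLabelling C = labelling (b 0F) (b 1F) (b 2F) (b 3F) (b 4F) (b 5F)
  where b = boundedCanonical C

canonicalLabelling≗canonical : ∀ C → canonicalLabelling C ≗ canonical C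
canonicalLabelling≗canonical C 0F = toℕ-injective (toℕ-↑ˡ-boundedCanonical C 0F 5)
canonicalLabelling≗canonical C 1F = toℕ-injective (toℕ-↑ˡ-boundedCanonical C 1F 4)
canonicalLabelling≗canonical C 2F = toℕ-injective (toℕ-↑ˡ-boundedCanonical C 2F 3)
canonicalLabelling≗canonical C 3F = toℕ-injective (toℕ-↑ˡ-boundedCanonical C 3F 2)
canonicalLabelling≗canonical C 4F = toℕ-injective (toℕ-↑ˡ-boundedCanonical C 4F 1)
canonicalLabelling≗canonical C 5F = toℕ-injective (toℕ-fromℕ< _)

∀-clustering₆ : {P : Clustering 6 → Set} → (∀ {C C′} → SamePartition C C′ → P C → P C′) →
                (∀ a b c d e f → P (labelling a b c d e f)) → ∀ C → P C
∀-clustering₆ transport P-labelling C = transport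
  (SamePartition-trans (≗⇒SamePartition (canonicalLabelling≗canonical C)) (canonical-samePartition C))
  (P-labelling (b 0F) (b 1F) (b 2F) (b 3F) (b 4F) (b 5F))
  where b = boundedCanonical C

HubLabelled : ∀ {n} → Network n → Clustering n → Set
HubLabelled N C = ∀ u → C (C u) ≡ C u × (u ≡ C u ⊎ adj N u (C u) ≡ true)

hubLabelled? : ∀ {n} (N : Network n) C → Dec (HubLabelled N C)
hubLabelled? N C = all? λ u → (C (C u) ≟ C u) ×-dec ((u ≟ C u) ⊎-dec (adj N u (C u) Bool.≟ true))

hubLabelled⇒admissible : ∀ {n} {N : Network n} {C} → HubLabelled N C → Admissible N C
hubLabelled⇒admissible {N = N} {C} hub u v Cu≡Cv = fromStart (fromHub (proj₂ (hub v)))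
  where
  P = λ x → C x ≡ C u
  fromHub : v ≡ C v ⊎ adj N v (C v) ≡ true → WalkIn N P (C u) v
  fromHub (inj₁ v≡Cv)      = subst (WalkIn N P (C u)) (trans Cu≡Cv (≡.sym v≡Cv)) (here (proj₁ (hub u)))
  fromHub (inj₂ adjacent) = step (proj₁ (hub u))
    (subst (λ h → adj N h v ≡ true) (≡.sym Cu≡Cv) (trans (sym N (C v) v) adjacent)) (here (≡.sym Cu≡Cv))
  fromStart : WalkIn N P (C u) v → WalkIn N P u v
  fromStart walk with proj₂ (hub u)
  ... | inj₁ u≡Cu     = subst (λ x → WalkIn N P x v) (≡.sym u≡Cu) walk
  ... | inj₂ adjacent = step refl adjacent walk

undirected : ∀ {n} (E : Fin n → Fin n → Bool) → (∀ i → E i i ≡ false) → Network n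
undirected E irreflexive = record
  { adj    = λ i j → E i j ∨ E j i
  ; sym    = λ i j → ∨-comm (E i j) (E j i)
  ; irrefl = λ i → cong₂ _∨_ (irreflexive i) (irreflexive i)
  }

edgesN : ℕ → ℕ → Bool
edgesN 0 1 = true
edgesN 0 2 = true
edgesN 0 3 = true
edgesN 0 4 = true
edgesN 0 5 = true
edgesN 1 2 = true
edgesN 1 3 = true
edgesN _ _ = false

edgesN′ : ℕ → ℕ → Bool
edgesN′ 4 5 = true
edgesN′ i j = edgesN i j

N : Network 6
N = undirected (λ i j → edgesN (toℕ i) (toℕ j)) (toWitness {a? = all? λ i → edgesN (toℕ i) (toℕ i) Bool.≟ false} tt)

N′ : Network 6
N′ = undirected (λ i j → edgesN′ (toℕ i) (toℕ j)) (toWitness {a? = all? λ i → edgesN′ (toℕ i) (toℕ i) Bool.≟ false} tt)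

Γ : Clustering 6
Γ = labelling 0F 1F 1F 1F 0F 0F

Δ : Clustering 6
Δ = labelling 0F 0F 0F 0F 4F 4F

-- Tabulated degrees keep the exhaustive checks fast; they are checked against degree.
degreesN : Fin 6 → ℕ
degreesN = lookup (5 ∷ 3 ∷ 2 ∷ 2 ∷ 1 ∷ 1 ∷ [])

degreesN′ : Fin 6 → ℕ
degreesN′ = lookup (5 ∷ 3 ∷ 2 ∷ 2 ∷ 2 ∷ 2 ∷ [])

modularity-N : ∀ C → modularity N C ≡ score 7 (edgeWeight N) degreesN C / 196
modularity-N C = trans (modularity′≡score 6 N C)
  (cong (_/ 196) (score-cong-degrees 7 (edgeWeight N) (toWitness {a? = all? λ i → degree N i ℕ.≟ degreesN i} tt) C))

modularity-N′ : ∀ C → modularity N′ C ≡ score 8 (edgeWeight N′) degreesN′ C / 256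
modularity-N′ C = trans (modularity′≡score 7 N′ C)
  (cong (_/ 256) (score-cong-degrees 8 (edgeWeight N′) (toWitness {a? = all? λ i → degree N′ i ℕ.≟ degreesN′ i} tt) C))

Γ-maximises-score : ∀ C → score 7 (edgeWeight N) degreesN C ℤ.≤ score 7 (edgeWeight N) degreesN Γ
Γ-maximises-score = ∀-clustering₆ (λ same → subst (ℤ._≤ _) (score-cong 7 (edgeWeight N) degreesN same))
  (toWitness {a? = ∀-labelling? λ C →
    score 7 (edgeWeight N) degreesN C ℤ.≤? score 7 (edgeWeight N) degreesN Γ} tt)

Δ-beats-refinements : ∀ C → Refines C Γ → score 8 (edgeWeight N′) degreesN′ C ℤ.< score 8 (edgeWeight N′) degreesN′ Δ
Δ-beats-refinements = ∀-clustering₆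
  (λ same P-C C′⊑Γ → subst (ℤ._< _) (score-cong 8 (edgeWeight N′) degreesN′ same)
                                     (P-C (Refines-trans (proj₁ same) C′⊑Γ)))
  (toWitness {a? = ∀-labelling? λ C → refines? C Γ →-dec
    (score 8 (edgeWeight N′) degreesN′ C ℤ.<? score 8 (edgeWeight N′) degreesN′ Δ)} tt)

Γ-optimal : ModOptimal N Γ
Γ-optimal = s≤s z≤n
          , hubLabelled⇒admissible (toWitness {a? = hubLabelled? N Γ} tt)
          , λ C _ → ≡.subst₂ ℚ._≤_ (≡.sym (modularity-N C)) (≡.sym (modularity-N Γ))
                                  (/-mono-≤ 195 (Γ-maximises-score C))

N′-adds-intra-edges : AddsIntraEdges N Γ N′
N′-adds-intra-edges =
    toWitness {a? = all? λ i → all? λ j → (adj N i j Bool.≟ true) →-dec (adj N′ i j Bool.≟ true)} tt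
  , toWitness {a? = all? λ i → all? λ j → (adj N′ i j Bool.≟ true) →-dec ((adj N i j Bool.≟ false) →-dec (Γ i ≟ Γ j))} tt

no-optimal-refinement : ∀ C → ModOptimal N′ C → ¬ Refines C Γ
no-optimal-refinement C (_ , _ , optimal) C⊑Γ =
  ℚ.<-irrefl refl (ℚ.<-≤-trans modularity-C<Δ (optimal Δ Δ-admissible))
  where
  modularity-C<Δ : modularity N′ C ℚ.< modularity N′ Δ
  modularity-C<Δ = ≡.subst₂ ℚ._<_ (≡.sym (modularity-N′ C)) (≡.sym (modularity-N′ Δ))
                            (/-mono-< 255 (Δ-beats-refinements C C⊑Γ))
  Δ-admissible : Admissible N′ Δ
  Δ-admissible = hubLabelled⇒admissible (toWitness {a? = hubLabelled? N′ Δ} tt)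

lemma8 : Σ ℕ λ n → Σ (Network n) λ N → Σ (Clustering n) λ Γ → Σ (Network n) λ N' →
           ModOptimal N Γ × AddsIntraEdges N Γ N' × ¬ ModOptimal N' Γ ×
           (∀ C → ModOptimal N' C → ¬ Refines C Γ)
lemma8 = 6 , N , Γ , N′ , Γ-optimal , N′-adds-intra-edges
       , (λ Γ-optimal′ → no-optimal-refinement Γ Γ-optimal′ (λ _ _ → id))
       , no-optimal-refinement
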